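{- Let $p\ge 5$ be a prime. A $\Phi_{p-2}$-sequence $(a_n)_{n\in\mathbb{Z}}$ in $\mathbb{F}_p$ is a complete $\Phi_{p-2}$-sequence if and only if $a_n=b^n$ for all $n$, where $b$ is a $\Phi_{p-2}$-primitive root.
   Context: For a prime $p\ge 5$ and $\kappa\in\{2,\dots,p-2\}$, a sequence $(a_n)_{n\in\mathbb{Z}}$ of elements of $\mathbb{F}_p$ is a $\Phi_\kappa$-sequence if $a_0=1$ and $a_{n+\kappa}=a_n+a_{n+1}$ in $\mathbb{F}_p$ for all $n\in\mathbb{Z}$. It is complete if it is periodic with period $p-1$ and $\{a_1,\dots,a_{p-2}\}=\{2,\dots,p-1\}$. A $\Phi_\kappa$-primitive root is a primitive root $b$ mod $p$ (in $\mathbb{F}_p$) with $b^\kappa=b+1$. -}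

module Defs where

open import Data.Nat using (ℕ; zero; suc; _+_; _*_; _∸_; _≤_; _<_; NonZero)
open import Data.Nat.DivMod using (_mod_)
open import Data.Fin using (Fin; toℕ)
open import Data.Integer using (ℤ; +_; -_) renaming (_+_ to _+ℤ_)
open import Data.Product using (Σ; _×_; _,_)
open import Relation.Binary.PropositionalEquality using (_≡_; _≢_)

module _ (p : ℕ) .{{_ : NonZero p}} where

  𝔽 : Set
  𝔽 = Fin p

  one : 𝔽
  one = 1 mod p

  _⊕_ : 𝔽 → 𝔽 → 𝔽
  x ⊕ y = (toℕ x + toℕ y) mod p

  _⊗_ : 𝔽 → 𝔽 → 𝔽
  x ⊗ y = (toℕ x * toℕ y) mod p

  pow : 𝔽 → ℕ → 𝔽
  pow b zero    = one
  pow b (suc k) = b ⊗ pow b k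

  IsΦSeq : ℕ → (ℤ → 𝔽) → Set
  IsΦSeq κ a = (a (+ 0) ≡ one) × (∀ n → a (n +ℤ + κ) ≡ a n ⊕ a (n +ℤ + 1))

  IsComplete : (ℤ → 𝔽) → Set
  IsComplete a =
      (∀ n → a (n +ℤ + (p ∸ 1)) ≡ a n)
    × (∀ i → 1 ≤ i → i ≤ p ∸ 2 → 2 ≤ toℕ (a (+ i)))
    × (∀ (x : 𝔽) → 2 ≤ toℕ x → Σ ℕ λ i → (1 ≤ i) × (i ≤ p ∸ 2) × (a (+ i) ≡ x))

  IsPrimitiveRoot : 𝔽 → Set
  IsPrimitiveRoot b = (pow b (p ∸ 1) ≡ one) × (∀ k → 1 ≤ k → k < p ∸ 1 → pow b k ≢ one)

  IsΦPrimitiveRoot : ℕ → 𝔽 → Set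
  IsΦPrimitiveRoot κ b = IsPrimitiveRoot b × (pow b κ ≡ b ⊕ one)

  -- a_n = b^n for all n ∈ ℤ: for n = k ≥ 0 this is a_k = b^k, and for
  -- n = -k it says a_{-k} is the multiplicative inverse of b^k.
  IsPowerSeq : 𝔽 → (ℤ → 𝔽) → Set
  IsPowerSeq b a = (∀ k → a (+ k) ≡ pow b k) × (∀ k → a (- (+ k)) ⊗ pow b k ≡ one)

module Submission where

open import Defs
open import Data.Nat using (ℕ; _≤_; _∸_)
open import Data.Nat.Primality using (Prime; prime⇒nonZero)
open import Data.Integer using (ℤ)
open import Data.Product using (Σ; _×_)
open import Function.Bundles using (_⇔_)

open import Data.Fin using (Fin; zero; suc; toℕ; fromℕ<; punchOut)
open import Data.Fin.Permutation using (permutation)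
open import Data.Fin.Properties
  using (toℕ-injective; toℕ-fromℕ<; toℕ<n; any?; _≟_; injective⇒≤; punchOut-injective)
open import Data.Integer as ℤ using (+_; -[1+_]; _+_; _*_; _-_; -_)
import Data.Integer.Properties as ℤ
open import Algebra.Properties.Semiring.Sum ℤ.+-*-semiring
  using (sum; sum-syntax; sum-permute; *-distribˡ-sum)
open import Data.Integer.Divisibility.Signed
  using (_∣_; divides; ∣-refl; ∣⇒∣ᵤ; ∣ᵤ⇒∣; ∣m∣n⇒∣m+n; ∣m⇒∣-m; ∣m⇒∣m*n; ∣n⇒∣m*n)
open import Data.Integer.Tactic.RingSolver using (solve-∀)
open import Data.Nat as ℕ using (zero; suc; _<_; z≤n; s≤s; nonTrivial⇒n>1)
import Data.Nat.Divisibility as ℕ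
import Data.Nat.Properties as ℕ
open import Data.Nat.DivMod using (_mod_; _%_; _/_; m≡m%n+[m/n]*n; m%n<n)
open import Data.Nat.Primality using (euclidsLemma; prime⇒nonTrivial)
open import Data.Product using (∃; _,_; proj₁; proj₂)
open import Data.Sum using (_⊎_; inj₁; inj₂)
open import Function using (_∘_; mk⇔)
open import Function.Definitions using (Injective)
open import Relation.Binary.Bundles using (Setoid)
open import Relation.Binary.PropositionalEquality
  using (_≡_; _≢_; refl; sym; trans; cong; cong₂; subst; module ≡-Reasoning)
import Relation.Binary.Reasoning.Setoid as SetoidReasoning
open import Relation.Binary.Definitions using (tri<; tri≈; tri>)
open import Relation.Nullary using (¬_; yes; no; contradiction)
open import Level using (0ℓ)

-- All arithmetic is done in ℤ modulo p, reading a residue x ∈ 𝔽_p as the integer toℕ x.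
--
-- (⇒) Periodicity turns a_{n+p−2} = a_n + a_{n+1} into a_{n−1} = a_n + a_{n+1}. Along this
-- recurrence N(a_k, a_{k+1})² is constant, where N(x, y) = y² + xy − x², and 25x⁴ − 6N(x, y)²
-- telescopes, so summing over a period gives 25 ∑ a_k⁴ ≡ 6(p − 1)N² ≡ −6N². Completeness says
-- that a_0, …, a_{p−2} run through 𝔽_p^×, so ∑ a_k⁴ ≡ ∑_{x<p} x⁴ ≡ 0 by Faulhaber's formula.
-- Hence 36N² ≡ 0, and as p ≥ 5 this forces N(1, b) = b² + b − 1 ≡ 0 for b = a_1. Then
-- a_{n+1} = b·a_n for all n ∈ ℤ, so a_n = bⁿ; b is a primitive root because a_1, …, a_{p−2} ≠ 1,
-- and b^{p−2} = a_{p−2} = a_0 + a_1 = 1 + b.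
--
-- (⇐) The powers b⁰, …, b^{p−2} of a primitive root are nonzero and pairwise distinct, so together
-- with 0 they enumerate 𝔽_p, and b¹, …, b^{p−2} fill {2, …, p − 1}.

injective⇒surjective : ∀ {n} (f : Fin n → Fin n) → Injective _≡_ _≡_ f → ∀ y → ∃ λ x → f x ≡ y
injective⇒surjective {suc n} f f-injective y with any? (λ x → f x ≟ y)
... | yes hit  = hit
... | no  miss = contradiction (injective⇒≤ punchedOut-injective) ℕ.1+n≰n
  where
  y≢f : ∀ x → y ≢ f x
  y≢f x y≡fx = miss (x , sym y≡fx)
  punchedOut-injective : Injective _≡_ _≡_ (λ x → punchOut (y≢f x))
  punchedOut-injective eq = f-injective (punchOut-injective (y≢f _) (y≢f _) eq)

∑-reindex-surjective : ∀ {n} (f : Fin n → Fin n) → (∀ y → ∃ λ x → f x ≡ y) →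
                       (h : Fin n → ℤ) → sum h ≡ sum (h ∘ f)
∑-reindex-surjective {n} f f-surjective h = sum-permute h (permutation f g f∘g g∘f)
  where
  g : Fin n → Fin n
  g y = proj₁ (f-surjective y)
  f∘g : ∀ y → f (g y) ≡ y
  f∘g y = proj₂ (f-surjective y)
  g-injective : Injective _≡_ _≡_ g
  g-injective {y} {y′} gy≡gy′ = trans (sym (f∘g y)) (trans (cong f gy≡gy′) (f∘g y′))
  g∘f : ∀ x → g (f x) ≡ x
  g∘f x with injective⇒surjective g g-injective x
  ... | y , refl = cong g (f∘g y)

infix 8 _⁴
_⁴ : ℤ → ℤ
x ⁴ = x * x * x * x

-- faulhaber₄ n = 30 · ∑_{j<n} j⁴
faulhaber₄ : ℤ → ℤ
faulhaber₄ n = n * (n - + 1) * (+ 2 * n - + 1) * (+ 3 * n * n - + 3 * n - + 1)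

faulhaber₄-step : ∀ n → + 30 * n ⁴ ≡ faulhaber₄ (+ 1 + n) - faulhaber₄ n
faulhaber₄-step = expanded
  where
  -- solve-∀ does not unfold definitions, so the identity is restated in expanded form.
  expanded : ∀ n → + 30 * (n * n * n * n) ≡
    (+ 1 + n) * (+ 1 + n - + 1) * (+ 2 * (+ 1 + n) - + 1) * (+ 3 * (+ 1 + n) * (+ 1 + n) - + 3 * (+ 1 + n) - + 1)
    - n * (n - + 1) * (+ 2 * n - + 1) * (+ 3 * n * n - + 3 * n - + 1)
  expanded = solve-∀

-- The recurrence b_{k+2} = b_k − b_{k+1} acts on consecutive pairs by (x, y) ↦ (y, x − y);
-- norm is the norm form of its characteristic polynomial X² + X − 1 and changes sign under it.
norm : ℤ → ℤ → ℤ
norm x y = y * y + x * y - x * x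

norm-shift : ∀ x y → norm y (x - y) ≡ - norm x y
norm-shift = expanded
  where
  expanded : ∀ x y → (x - y) * (x - y) + y * (x - y) - y * y ≡ - (y * y + x * y - x * x)
  expanded = solve-∀

quarticPotential : ℤ → ℤ → ℤ
quarticPotential x y = - (x * (+ 19 * (x * x * x) + y * (+ 14 * (x * x) + y * (+ 3 * x + y * + 2))))

-- Modulo the invariant norm², the fourth power is a coboundary for the shift.
fourth-power-telescopes : ∀ x y →
  + 25 * x ⁴ ≡ + 6 * (norm x y * norm x y) + (quarticPotential y (x - y) - quarticPotential x y)
fourth-power-telescopes = expanded
  where
  expanded : ∀ x y → + 25 * (x * x * x * x) ≡
    + 6 * ((y * y + x * y - x * x) * (y * y + x * y - x * x))
    + (- (y * (+ 19 * (y * y * y) + (x - y) * (+ 14 * (y * y) + (x - y) * (+ 3 * y + (x - y) * + 2))))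
       - - (x * (+ 19 * (x * x * x) + y * (+ 14 * (x * x) + y * (+ 3 * x + y * + 2)))))
  expanded = solve-∀

module Congruence (p : ℕ) where

  infix 4 _≈_
  record _≈_ (x y : ℤ) : Set where
    constructor mod-p
    field divides-difference : + p ∣ x - y

  private
    transport : ∀ {a b} → a ≡ b → + p ∣ a → + p ∣ b
    transport = subst (+ p ∣_)

  ≡⇒≈ : ∀ {x y} → x ≡ y → x ≈ y
  ≡⇒≈ {x} refl = mod-p (divides (+ 0) (ℤ.+-inverseʳ x))

  ≈-refl : ∀ {x} → x ≈ x
  ≈-refl = ≡⇒≈ refl

  ≈-sym : ∀ {x y} → x ≈ y → y ≈ x
  ≈-sym {x} {y} (mod-p d) = mod-p (transport (negate x y) (∣m⇒∣-m d))
    where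
    negate : ∀ x y → - (x - y) ≡ y - x
    negate = solve-∀

  ≈-trans : ∀ {x y z} → x ≈ y → y ≈ z → x ≈ z
  ≈-trans {x} {y} {z} (mod-p d) (mod-p e) = mod-p (transport (chain x y z) (∣m∣n⇒∣m+n d e))
    where
    chain : ∀ x y z → (x - y) + (y - z) ≡ x - z
    chain = solve-∀

  ≈-setoid : Setoid 0ℓ 0ℓ
  ≈-setoid = record
    { Carrier       = ℤ
    ; _≈_           = _≈_
    ; isEquivalence = record { refl = ≈-refl ; sym = ≈-sym ; trans = ≈-trans }
    }

  module ≈-Reasoning = SetoidReasoning ≈-setoid

  +-cong : ∀ {x y u v} → x ≈ y → u ≈ v → x + u ≈ y + v
  +-cong {x} {y} {u} {v} (mod-p d) (mod-p e) = mod-p (transport (regroup x y u v) (∣m∣n⇒∣m+n d e))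
    where
    regroup : ∀ x y u v → (x - y) + (u - v) ≡ (x + u) - (y + v)
    regroup = solve-∀

  *-cong : ∀ {x y u v} → x ≈ y → u ≈ v → x * u ≈ y * v
  *-cong {x} {y} {u} {v} (mod-p d) (mod-p e) =
    mod-p (transport (regroup x y u v) (∣m∣n⇒∣m+n (∣m⇒∣m*n u d) (∣n⇒∣m*n y e)))
    where
    regroup : ∀ x y u v → (x - y) * u + y * (u - v) ≡ x * u - y * v
    regroup = solve-∀

  -‿cong : ∀ {x y} → x ≈ y → - x ≈ - y
  -‿cong {x} {y} (mod-p d) = mod-p (transport (regroup x y) (∣m⇒∣-m d))
    where
    regroup : ∀ x y → - (x - y) ≡ - x - - y
    regroup = solve-∀

  -cong : ∀ {x y u v} → x ≈ y → u ≈ v → x - u ≈ y - v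
  -cong x≈y u≈v = +-cong x≈y (-‿cong u≈v)

  +-congˡ : ∀ x {u v} → u ≈ v → x + u ≈ x + v
  +-congˡ x = +-cong (≈-refl {x})

  *-congˡ : ∀ x {u v} → u ≈ v → x * u ≈ x * v
  *-congˡ x = *-cong (≈-refl {x})

  *-congʳ : ∀ x {u v} → u ≈ v → u * x ≈ v * x
  *-congʳ x u≈v = *-cong u≈v (≈-refl {x})

  -congˡ : ∀ x {u v} → u ≈ v → x - u ≈ x - v
  -congˡ x = -cong (≈-refl {x})

  x≈y+z⇒z≈x-y : ∀ {x y z} → x ≈ y + z → z ≈ x - y
  x≈y+z⇒z≈x-y {x} {y} {z} x≈y+z = ≈-trans (≡⇒≈ (cancel y z)) (-cong (≈-sym x≈y+z) (≈-refl {y}))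
    where
    cancel : ∀ y z → z ≡ y + z - y
    cancel = solve-∀

  ∣⇒≈0 : ∀ {x} → + p ∣ x → x ≈ + 0
  ∣⇒≈0 {x} d = mod-p (transport (sym (ℤ.+-identityʳ x)) d)

  ≈0⇒∣ : ∀ {x} → x ≈ + 0 → + p ∣ x
  ≈0⇒∣ {x} (mod-p d) = transport (ℤ.+-identityʳ x) d

  p≈0 : + p ≈ + 0
  p≈0 = ∣⇒≈0 ∣-refl

  norm-cong : ∀ {x x′ y y′} → x ≈ x′ → y ≈ y′ → norm x y ≈ norm x′ y′
  norm-cong x≈x′ y≈y′ = -cong (+-cong (*-cong y≈y′ y≈y′) (*-cong x≈x′ y≈y′)) (*-cong x≈x′ x≈x′)

  quarticPotential-congʳ : ∀ x {y y′} → y ≈ y′ → quarticPotential x y ≈ quarticPotential x y′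
  quarticPotential-congʳ x y≈y′ =
    -‿cong (*-congˡ x (+-congˡ (+ 19 * (x * x * x)) (*-cong y≈y′ (+-congˡ (+ 14 * (x * x))
      (*-cong y≈y′ (+-congˡ (+ 3 * x) (*-congʳ (+ 2) y≈y′)))))))

  ∑-telescope : ∀ m (u H : ℕ → ℤ) c → (∀ k → u k ≈ c + (H (suc k) - H k)) →
                ∑[ i < m ] (u (toℕ i)) ≈ + m * c + (H m - H 0)
  ∑-telescope zero    u H c step = ≡⇒≈ (empty c (H 0))
    where
    empty : ∀ c h → + 0 ≡ + 0 * c + (h - h)
    empty = solve-∀
  ∑-telescope (suc m) u H c step =
    ≈-trans (+-cong (step 0) (∑-telescope m (u ∘ suc) (H ∘ suc) c (step ∘ suc)))
            (≡⇒≈ (combine c (+ m) (H 0) (H 1) (H (suc m))))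
    where
    combine : ∀ c m h₀ h₁ hₘ → c + (h₁ - h₀) + (m * c + (hₘ - h₁)) ≡ (+ 1 + m) * c + (hₘ - h₀)
    combine = solve-∀

  30∑⁴≈0 : + 30 * ∑[ i < p ] ((+ toℕ i) ⁴) ≈ + 0
  30∑⁴≈0 = begin
    + 30 * ∑[ i < p ] ((+ toℕ i) ⁴)          ≡⟨ *-distribˡ-sum {p} (+ 30) (λ i → (+ toℕ i) ⁴) ⟩
    ∑[ i < p ] (+ 30 * (+ toℕ i) ⁴)          ≈⟨ ∑-telescope p _ (faulhaber₄ ∘ +_) (+ 0) (λ k → ≡⇒≈ (step k)) ⟩
    + p * + 0 + (faulhaber₄ (+ p) - + 0)   ≡⟨ cong₂ _+_ (ℤ.*-zeroʳ (+ p)) (ℤ.+-identityʳ (faulhaber₄ (+ p))) ⟩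
    + 0 + faulhaber₄ (+ p)                 ≈⟨ +-congˡ (+ 0) (∣⇒≈0 (∣m⇒∣m*n _ (∣m⇒∣m*n _ (∣m⇒∣m*n _ ∣-refl)))) ⟩
    + 0                                    ∎
    where
    open ≈-Reasoning
    step : ∀ k → + 30 * (+ k) ⁴ ≡ + 0 + (faulhaber₄ (+ suc k) - faulhaber₄ (+ k))
    step k = trans (faulhaber₄-step (+ k)) (sym (ℤ.+-identityˡ _))

  module _ (b : ℕ → ℤ) (recurrence : ∀ k → b (suc (suc k)) ≈ b k - b (suc k)) where

    private
      normAt : ℕ → ℤ
      normAt k = norm (b k) (b (suc k))

      potentialAt : ℕ → ℤ
      potentialAt k = quarticPotential (b k) (b (suc k))

    norm²-invariant : ∀ k → normAt k * normAt k ≈ normAt 0 * normAt 0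
    norm²-invariant zero    = ≈-refl
    norm²-invariant (suc k) =
      ≈-trans (*-cong flip flip) (≈-trans (≡⇒≈ (square-neg (normAt k))) (norm²-invariant k))
      where
      square-neg : ∀ x → - x * - x ≡ x * x
      square-neg = solve-∀
      flip : normAt (suc k) ≈ - normAt k
      flip = ≈-trans (norm-cong (≈-refl {b (suc k)}) (recurrence k)) (≡⇒≈ (norm-shift (b k) (b (suc k))))

    ∑-fourth-powers : ∀ m → + 25 * ∑[ i < m ] (b (toℕ i) ⁴) ≈
      + m * (+ 6 * (normAt 0 * normAt 0)) + (potentialAt m - potentialAt 0)
    ∑-fourth-powers m = ≈-trans (≡⇒≈ (*-distribˡ-sum {m} (+ 25) (λ i → b (toℕ i) ⁴)))
                                (∑-telescope m (λ k → + 25 * b k ⁴) potentialAt _ term)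
      where
      term : ∀ k → + 25 * b k ⁴ ≈ + 6 * (normAt 0 * normAt 0) + (potentialAt (suc k) - potentialAt k)
      term k = ≈-trans (≡⇒≈ (fourth-power-telescopes (b k) (b (suc k))))
        (+-cong (*-congˡ (+ 6) (norm²-invariant k))
                (-cong (quarticPotential-congʳ (b (suc k)) (≈-sym (recurrence k))) (≈-refl {potentialAt k})))

  module _ {a : ℤ → ℤ} (a₀ : a (+ 0) ≈ + 1) (golden : a (+ 1) * a (+ 1) + a (+ 1) ≈ + 1)
           (recurrence : ∀ n → a (ℤ.pred n) ≈ a n + a (ℤ.suc n)) where

    private
      β : ℤ
      β = a (+ 1)

    recurrence⇒geometric : ∀ n → a (ℤ.suc n) ≈ β * a n
    recurrence⇒geometric (+ zero) = ≈-trans (≡⇒≈ (sym (ℤ.*-identityʳ β))) (*-congˡ β (≈-sym a₀))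
    recurrence⇒geometric (+ suc k) = begin
      a (+ suc (suc k))                   ≈⟨ x≈y+z⇒z≈x-y (recurrence (+ suc k)) ⟩
      a (+ k) - a (+ suc k)               ≈⟨ -congˡ (a (+ k)) (recurrence⇒geometric (+ k)) ⟩
      a (+ k) - β * a (+ k)               ≡⟨ cong (_- β * a (+ k)) (ℤ.*-identityˡ (a (+ k))) ⟨
      + 1 * a (+ k) - β * a (+ k)         ≈⟨ -cong (*-congʳ (a (+ k)) (≈-sym golden)) ≈-refl ⟩
      (β * β + β) * a (+ k) - β * a (+ k) ≡⟨ regroup β (a (+ k)) ⟩
      β * (β * a (+ k))                   ≈⟨ *-congˡ β (recurrence⇒geometric (+ k)) ⟨
      β * a (+ suc k)                     ∎
      where
      open ≈-Reasoning
      regroup : ∀ b x → (b * b + b) * x - b * x ≡ b * (b * x)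
      regroup = solve-∀
    recurrence⇒geometric -[1+ zero ] = begin
      a (+ 0)                  ≈⟨ a₀ ⟩
      + 1                      ≈⟨ golden ⟨
      β * β + β                ≡⟨ regroup β ⟩
      β * (+ 1 + β)            ≈⟨ *-congˡ β (+-cong (≈-sym a₀) (≈-refl {β})) ⟩
      β * (a (+ 0) + a (+ 1))  ≈⟨ *-congˡ β (recurrence (+ 0)) ⟨
      β * a -[1+ 0 ]           ∎
      where
      open ≈-Reasoning
      regroup : ∀ b → b * b + b ≡ b * (+ 1 + b)
      regroup = solve-∀
    recurrence⇒geometric -[1+ suc k ] = begin
      a -[1+ k ]                            ≡⟨ ℤ.*-identityˡ (a -[1+ k ]) ⟨
      + 1 * a -[1+ k ]                      ≈⟨ *-congʳ (a -[1+ k ]) golden ⟨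
      (β * β + β) * a -[1+ k ]              ≡⟨ regroup β (a -[1+ k ]) ⟩
      β * (a -[1+ k ] + β * a -[1+ k ])     ≈⟨ *-congˡ β (+-congˡ (a -[1+ k ]) (recurrence⇒geometric -[1+ k ])) ⟨
      β * (a -[1+ k ] + a (ℤ.suc -[1+ k ])) ≈⟨ *-congˡ β (recurrence -[1+ k ]) ⟨
      β * a -[1+ suc k ]                    ∎
      where
      open ≈-Reasoning
      regroup : ∀ b x → (b * b + b) * x ≡ b * (x + b * x)
      regroup = solve-∀

module PrimeCongruence (p : ℕ) (pr : Prime p) where

  open Congruence p

  ∣*⇒∣⊎∣ : ∀ x y → + p ∣ x * y → + p ∣ x ⊎ + p ∣ y
  ∣*⇒∣⊎∣ x y p∣xy with euclidsLemma ℤ.∣ x ∣ ℤ.∣ y ∣ pr (subst (p ℕ.∣_) (ℤ.abs-* x y) (∣⇒∣ᵤ p∣xy))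
  ... | inj₁ p∣x = inj₁ (∣ᵤ⇒∣ p∣x)
  ... | inj₂ p∣y = inj₂ (∣ᵤ⇒∣ p∣y)

  ∣x*x⇒∣x : ∀ x → + p ∣ x * x → + p ∣ x
  ∣x*x⇒∣x x p∣xx with ∣*⇒∣⊎∣ x x p∣xx
  ... | inj₁ p∣x = p∣x
  ... | inj₂ p∣x = p∣x

  1≉0 : ¬ (+ 1 ≈ + 0)
  1≉0 1≈0 = ℕ.<⇒≱ (nonTrivial⇒n>1 p) (ℕ.∣⇒≤ (∣⇒∣ᵤ (≈0⇒∣ 1≈0)))
    where instance _ = prime⇒nonTrivial pr

  *≈1⇒∤ʳ : ∀ {x y} → x * y ≈ + 1 → ¬ + p ∣ y
  *≈1⇒∤ʳ {x} {y} xy≈1 p∣y =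
    1≉0 (≈-trans (≈-sym xy≈1) (≈-trans (*-congˡ x (∣⇒≈0 p∣y)) (≡⇒≈ (ℤ.*-zeroʳ x))))

  *-cancelʳ-≈ : ∀ {x y z} → ¬ + p ∣ z → x * z ≈ y * z → x ≈ y
  *-cancelʳ-≈ {x} {y} {z} p∤z (mod-p p∣xz-yz)
    with ∣*⇒∣⊎∣ (x - y) z (subst (+ p ∣_) (factor x y z) p∣xz-yz)
    where
    factor : ∀ x y z → x * z - y * z ≡ (x - y) * z
    factor = solve-∀
  ... | inj₁ p∣x-y = mod-p p∣x-y
  ... | inj₂ p∣z   = contradiction p∣z p∤z

  ∣-*-cancel : ∀ {c} x → 0 < c → c < p → + p ∣ + c * x → + p ∣ x
  ∣-*-cancel {c} x 0<c c<p p∣cx with ∣*⇒∣⊎∣ (+ c) x p∣cx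
  ... | inj₁ p∣c = contradiction (ℕ.∣⇒≤ {{ℕ.>-nonZero 0<c}} (∣⇒∣ᵤ p∣c)) (ℕ.<⇒≱ c<p)
  ... | inj₂ p∣x = p∣x

backward-recurrence : ∀ {p} .{{_ : ℕ.NonZero p}} {κ} {a : ℤ → 𝔽 p} → IsΦSeq p κ a →
                      (∀ n → a (n + + suc κ) ≡ a n) → ∀ n → a (ℤ.pred n) ≡ _⊕_ p (a n) (a (ℤ.suc n))
backward-recurrence {p} {κ} {a} (_ , step) periodic n = begin
  a (ℤ.pred n)                ≡⟨ periodic (ℤ.pred n) ⟨
  a (ℤ.pred n + + suc κ)      ≡⟨ cong a (shift n (+ κ)) ⟩
  a (n + + κ)                 ≡⟨ step n ⟩
  _⊕_ p (a n) (a (n + + 1))   ≡⟨ cong (λ m → _⊕_ p (a n) (a m)) (ℤ.+-comm n (+ 1)) ⟩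
  _⊕_ p (a n) (a (ℤ.suc n))   ∎
  where
  open ≡-Reasoning
  shift : ∀ n k → (- + 1 + n) + (+ 1 + k) ≡ n + k
  shift = solve-∀

-- For a with a₀ = 1, completeness says exactly that 0, a₀, …, a_{p−2} enumerate 𝔽_p.
withZero : ∀ {n} → (ℤ → Fin (suc n)) → Fin (suc n) → Fin (suc n)
withZero a zero    = zero
withZero a (suc i) = a (+ toℕ i)

suc-[1+k]≡-k : ∀ k → ℤ.suc -[1+ k ] ≡ - + k
suc-[1+k]≡-k zero    = refl
suc-[1+k]≡-k (suc k) = refl

-- Writing p = q + 2 makes p ∸ 1 and p ∸ 2 compute to suc q and q.
module Residues (q : ℕ) where

  p : ℕ
  p = 2 ℕ.+ q

  open Congruence p

  infixl 6 _⊕ₚ_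
  infixl 7 _⊗ₚ_

  _⊕ₚ_ _⊗ₚ_ : 𝔽 p → 𝔽 p → 𝔽 p
  _⊕ₚ_ = _⊕_ p
  _⊗ₚ_ = _⊗_ p

  ⟦_⟧ : 𝔽 p → ℤ
  ⟦ x ⟧ = + toℕ x

  ⟦mod⟧ : ∀ m → ⟦ m mod p ⟧ ≈ + m
  ⟦mod⟧ m = ≈-sym (mod-p (divides (+ quotient) (begin
    + m - ⟦ m mod p ⟧
      ≡⟨ cong₂ (λ n r → + n - + r) (m≡m%n+[m/n]*n m p) (toℕ-fromℕ< (m%n<n m p)) ⟩
    + (rest ℕ.+ quotient ℕ.* p) - + rest   ≡⟨ cong (_- + rest) (ℤ.pos-+ rest (quotient ℕ.* p)) ⟩
    + rest + + (quotient ℕ.* p) - + rest   ≡⟨ cancel (+ rest) _ ⟩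
    + (quotient ℕ.* p)                     ≡⟨ ℤ.pos-* quotient p ⟩
    + quotient * + p                       ∎)))
    where
    open ≡-Reasoning
    rest quotient : ℕ
    rest     = m % p
    quotient = m / p
    cancel : ∀ r s → r + s - r ≡ s
    cancel = solve-∀

  ⟦⊕⟧ : ∀ x y → ⟦ x ⊕ₚ y ⟧ ≈ ⟦ x ⟧ + ⟦ y ⟧
  ⟦⊕⟧ x y = ≈-trans (⟦mod⟧ (toℕ x ℕ.+ toℕ y)) (≡⇒≈ (ℤ.pos-+ (toℕ x) (toℕ y)))

  ⟦⊗⟧ : ∀ x y → ⟦ x ⊗ₚ y ⟧ ≈ ⟦ x ⟧ * ⟦ y ⟧
  ⟦⊗⟧ x y = ≈-trans (⟦mod⟧ (toℕ x ℕ.* toℕ y)) (≡⇒≈ (ℤ.pos-* (toℕ x) (toℕ y)))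

  ⟦⟧-injective : ∀ {x y} → ⟦ x ⟧ ≈ ⟦ y ⟧ → x ≡ y
  ⟦⟧-injective {x} {y} (mod-p p∣x-y) =
    toℕ-injective (ℤ.+-injective (ℤ.i-j≡0⇒i≡j _ _ (ℤ.∣i∣≡0⇒i≡0 (multiple<p (∣⇒∣ᵤ p∣x-y) distance<p))))
    where
    multiple<p : ∀ {n} → p ℕ.∣ n → n < p → n ≡ 0
    multiple<p {zero}  _   _   = refl
    multiple<p {suc n} p∣n n<p = contradiction p∣n (ℕ.>⇒∤ n<p)
    distance<p : ℤ.∣ ⟦ x ⟧ - ⟦ y ⟧ ∣ < p
    distance<p = subst (λ d → ℤ.∣ d ∣ < p) (sym (ℤ.m-n≡m⊖n (toℕ x) (toℕ y)))
                   (ℕ.≤-<-trans (ℤ.∣m⊝n∣≤m⊔n (toℕ x) (toℕ y)) (ℕ.⊔-lub (toℕ<n x) (toℕ<n y)))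

  ⊕ₚ-comm : ∀ x y → x ⊕ₚ y ≡ y ⊕ₚ x
  ⊕ₚ-comm x y = cong (_mod p) (ℕ.+-comm (toℕ x) (toℕ y))

  2≤toℕ : ∀ {x : 𝔽 p} → x ≢ zero → x ≢ one p → 2 ≤ toℕ x
  2≤toℕ {zero}        x≢0 _   = contradiction refl x≢0
  2≤toℕ {suc zero}     _   x≢1 = contradiction refl x≢1
  2≤toℕ {suc (suc _)}  _   _   = s≤s (s≤s z≤n)

  Geometric : 𝔽 p → (ℤ → 𝔽 p) → Set
  Geometric b a = ∀ n → a (ℤ.suc n) ≡ b ⊗ₚ a n

  module _ {b : 𝔽 p} {a : ℤ → 𝔽 p} (geometric : Geometric b a) where

    geometric⇒powerSeq : a (+ 0) ≡ one p → IsPowerSeq p b a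
    geometric⇒powerSeq a₀ = powers , inverses
      where
      powers : ∀ k → a (+ k) ≡ pow p b k
      powers zero    = a₀
      powers (suc k) = trans (geometric (+ k)) (cong (b ⊗ₚ_) (powers k))
      inverses : ∀ k → a (- + k) ⊗ₚ pow p b k ≡ one p
      inverses zero    = ⟦⟧-injective (≈-trans (⟦⊗⟧ (a (+ 0)) (one p))
                                        (≡⇒≈ (trans (ℤ.*-identityʳ ⟦ a (+ 0) ⟧) (cong ⟦_⟧ a₀))))
      inverses (suc k) = ⟦⟧-injective (begin
        ⟦ a -[1+ k ] ⊗ₚ (b ⊗ₚ pow p b k) ⟧       ≈⟨ ⟦⊗⟧ (a -[1+ k ]) _ ⟩
        ⟦ a -[1+ k ] ⟧ * ⟦ b ⊗ₚ pow p b k ⟧      ≈⟨ *-congˡ ⟦ a -[1+ k ] ⟧ (⟦⊗⟧ b _) ⟩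
        ⟦ a -[1+ k ] ⟧ * (⟦ b ⟧ * ⟦ pow p b k ⟧)  ≡⟨ regroup ⟦ a -[1+ k ] ⟧ ⟦ b ⟧ _ ⟩
        ⟦ b ⟧ * ⟦ a -[1+ k ] ⟧ * ⟦ pow p b k ⟧    ≈⟨ *-congʳ ⟦ pow p b k ⟧ (⟦⊗⟧ b _) ⟨
        ⟦ b ⊗ₚ a -[1+ k ] ⟧ * ⟦ pow p b k ⟧       ≡⟨ cong (λ x → ⟦ x ⟧ * ⟦ pow p b k ⟧) (geometric -[1+ k ]) ⟨
        ⟦ a (ℤ.suc -[1+ k ]) ⟧ * ⟦ pow p b k ⟧    ≡⟨ cong (λ n → ⟦ a n ⟧ * ⟦ pow p b k ⟧) (suc-[1+k]≡-k k) ⟩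
        ⟦ a (- + k) ⟧ * ⟦ pow p b k ⟧             ≈⟨ ⟦⊗⟧ (a (- + k)) _ ⟨
        ⟦ a (- + k) ⊗ₚ pow p b k ⟧                ≡⟨ cong ⟦_⟧ (inverses k) ⟩
        ⟦ one p ⟧                                 ∎)
        where
        open ≈-Reasoning
        regroup : ∀ x y z → x * (y * z) ≡ y * x * z
        regroup = solve-∀

    geometric-shift : ∀ n j → ⟦ a (n + + j) ⟧ ≈ ⟦ pow p b j ⟧ * ⟦ a n ⟧
    geometric-shift n zero    = ≡⇒≈ (trans (cong (⟦_⟧ ∘ a) (ℤ.+-identityʳ n)) (sym (ℤ.*-identityˡ ⟦ a n ⟧)))
    geometric-shift n (suc j) = begin
      ⟦ a (n + + suc j) ⟧                     ≡⟨ cong (⟦_⟧ ∘ a) (shift n (+ j)) ⟩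
      ⟦ a (ℤ.suc (n + + j)) ⟧                 ≡⟨ cong ⟦_⟧ (geometric (n + + j)) ⟩
      ⟦ b ⊗ₚ a (n + + j) ⟧                    ≈⟨ ⟦⊗⟧ b _ ⟩
      ⟦ b ⟧ * ⟦ a (n + + j) ⟧                 ≈⟨ *-congˡ ⟦ b ⟧ (geometric-shift n j) ⟩
      ⟦ b ⟧ * (⟦ pow p b j ⟧ * ⟦ a n ⟧)       ≡⟨ ℤ.*-assoc ⟦ b ⟧ _ _ ⟨
      ⟦ b ⟧ * ⟦ pow p b j ⟧ * ⟦ a n ⟧         ≈⟨ *-congʳ ⟦ a n ⟧ (⟦⊗⟧ b _) ⟨
      ⟦ pow p b (suc j) ⟧ * ⟦ a n ⟧           ∎
      where
      open ≈-Reasoning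
      shift : ∀ n j → n + (+ 1 + j) ≡ + 1 + (n + j)
      shift = solve-∀

    geometric-periodic : ∀ {m} → pow p b m ≡ one p → ∀ n → a (n + + m) ≡ a n
    geometric-periodic {m} bᵐ≡1 n = ⟦⟧-injective (≈-trans (geometric-shift n m)
      (≡⇒≈ (trans (cong (λ x → ⟦ x ⟧ * ⟦ a n ⟧) bᵐ≡1) (ℤ.*-identityˡ ⟦ a n ⟧))))

  module Forward (pr : Prime p) (3<p : 3 < p)
                 {a : ℤ → 𝔽 p} (seq : IsΦSeq p q a) (complete : IsComplete p a) where

    open PrimeCongruence p pr

    private
      a₀ : a (+ 0) ≡ one p
      a₀ = proj₁ seq

      periodic : ∀ n → a (n + + suc q) ≡ a n
      periodic = proj₁ complete

      values≥2 : ∀ i → 1 ≤ i → i ≤ q → 2 ≤ toℕ (a (+ i))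
      values≥2 = proj₁ (proj₂ complete)

      values-onto : ∀ x → 2 ≤ toℕ x → Σ ℕ λ i → (1 ≤ i) × (i ≤ q) × (a (+ i) ≡ x)
      values-onto = proj₂ (proj₂ complete)

      A : ℤ → ℤ
      A n = ⟦ a n ⟧

      B : ℕ → ℤ
      B k = A (+ k)

    recurrence : ∀ n → A (ℤ.pred n) ≈ A n + A (ℤ.suc n)
    recurrence n = ≈-trans (≡⇒≈ (cong ⟦_⟧ (backward-recurrence seq periodic n))) (⟦⊕⟧ (a n) (a (ℤ.suc n)))

    withZero-surjective : ∀ y → ∃ λ x → withZero a x ≡ y
    withZero-surjective zero       = zero , refl
    withZero-surjective (suc zero) = suc zero , a₀
    withZero-surjective y@(suc (suc _))
      with i , _ , i≤q , aᵢ≡y ← values-onto y (s≤s (s≤s z≤n)) =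
      suc (fromℕ< (s≤s i≤q)) , trans (cong (a ∘ +_) (toℕ-fromℕ< (s≤s i≤q))) aᵢ≡y

    ∑⁴-over-period : ∑[ i < suc q ] (B (toℕ i) ⁴) ≡ ∑[ x < p ] (⟦ x ⟧ ⁴)
    ∑⁴-over-period = begin
      -- the term for x = 0 is 0⁴ = 0
      ∑[ i < suc q ] (B (toℕ i) ⁴)         ≡⟨ ℤ.+-identityˡ _ ⟨
      ∑[ x < p ] (⟦ withZero a x ⟧ ⁴)
        ≡⟨ ∑-reindex-surjective (withZero a) withZero-surjective (λ x → ⟦ x ⟧ ⁴) ⟨
      ∑[ x < p ] (⟦ x ⟧ ⁴)                 ∎
      where open ≡-Reasoning

    private
      S N : ℤ
      S = ∑[ i < suc q ] (B (toℕ i) ⁴)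
      N = norm (B 0) (B 1)

    30S≈0 : + 30 * S ≈ + 0
    30S≈0 = ≈-trans (≡⇒≈ (cong (+ 30 *_) ∑⁴-over-period)) 30∑⁴≈0

    25S≈6[p-1]N² : + 25 * S ≈ + suc q * (+ 6 * (N * N))
    25S≈6[p-1]N² = ≈-trans (∑-fourth-powers B B-recurrence (suc q))
      (≡⇒≈ (trans (cong (λ Ψ → X + (Ψ - Ψ₀)) potential-periodic) (cancel X Ψ₀)))
      where
      B-recurrence : ∀ k → B (suc (suc k)) ≈ B k - B (suc k)
      B-recurrence k = x≈y+z⇒z≈x-y {y = B (suc k)} (recurrence (+ suc k))
      X Ψ₀ : ℤ
      X  = + suc q * (+ 6 * (N * N))
      Ψ₀ = quarticPotential (B 0) (B 1)
      potential-periodic : quarticPotential (B (suc q)) (B (suc (suc q))) ≡ Ψ₀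
      potential-periodic = cong₂ quarticPotential (cong ⟦_⟧ (periodic (+ 0))) (cong ⟦_⟧ (periodic (+ 1)))
      cancel : ∀ x y → x + (y - y) ≡ x
      cancel = solve-∀

    p-1≈-1 : + suc q ≈ - + 1
    p-1≈-1 = ≈-trans (≡⇒≈ (predecessor (+ suc q))) (-cong p≈0 (≈-refl {+ 1}))
      where
      predecessor : ∀ x → x ≡ + 1 + x - + 1
      predecessor = solve-∀

    [6N]²≈0 : (+ 6 * N) * (+ 6 * N) ≈ + 0
    [6N]²≈0 = begin
      (+ 6 * N) * (+ 6 * N)                  ≡⟨ regroup₁ N ⟩
      - (+ 6 * (- + 1 * (+ 6 * (N * N))))    ≈⟨ -‿cong (*-congˡ (+ 6) (*-congʳ (+ 6 * (N * N)) p-1≈-1)) ⟨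
      - (+ 6 * (+ suc q * (+ 6 * (N * N))))  ≈⟨ -‿cong (*-congˡ (+ 6) 25S≈6[p-1]N²) ⟨
      - (+ 6 * (+ 25 * S))                   ≡⟨ regroup₂ S ⟩
      - (+ 5 * (+ 30 * S))                   ≈⟨ -‿cong (*-congˡ (+ 5) 30S≈0) ⟩
      + 0                                    ∎
      where
      open ≈-Reasoning
      regroup₁ : ∀ n → (+ 6 * n) * (+ 6 * n) ≡ - (+ 6 * (- + 1 * (+ 6 * (n * n))))
      regroup₁ = solve-∀
      regroup₂ : ∀ s → - (+ 6 * (+ 25 * s)) ≡ - (+ 5 * (+ 30 * s))
      regroup₂ = solve-∀

    N≈0 : N ≈ + 0
    N≈0 = ∣⇒≈0 (∣-*-cancel N (s≤s z≤n) 3<p (∣-*-cancel (+ 3 * N) (s≤s z≤n) 2<p p∣2*3N))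
      where
      2<p : 2 < p
      2<p = ℕ.<-trans (ℕ.n<1+n 2) 3<p
      p∣2*3N : + p ∣ + 2 * (+ 3 * N)
      p∣2*3N = subst (+ p ∣_) (ℤ.*-assoc (+ 2) (+ 3) N) (∣x*x⇒∣x (+ 6 * N) (≈0⇒∣ [6N]²≈0))

    golden : A (+ 1) * A (+ 1) + A (+ 1) ≈ + 1
    golden = begin
      A (+ 1) * A (+ 1) + A (+ 1)     ≡⟨ complete-square (A (+ 1)) ⟩
      norm (+ 1) (A (+ 1)) + + 1      ≡⟨ cong (λ a₀′ → norm a₀′ (A (+ 1)) + + 1) (cong ⟦_⟧ a₀) ⟨
      N + + 1                         ≈⟨ +-cong N≈0 (≈-refl {+ 1}) ⟩
      + 1                             ∎
      where
      open ≈-Reasoning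
      complete-square : ∀ b → b * b + b ≡ (b * b + + 1 * b - + 1 * + 1) + + 1
      complete-square = solve-∀

    geometric : Geometric (a (+ 1)) a
    geometric n = ⟦⟧-injective (≈-trans (recurrence⇒geometric {A} (≡⇒≈ (cong ⟦_⟧ a₀)) golden recurrence n)
                                        (≈-sym (⟦⊗⟧ (a (+ 1)) (a n))))

    powerSeq : IsPowerSeq p (a (+ 1)) a
    powerSeq = geometric⇒powerSeq geometric a₀

    primitiveRoot : IsPrimitiveRoot p (a (+ 1))
    primitiveRoot = order , minimal
      where
      order : pow p (a (+ 1)) (suc q) ≡ one p
      order = trans (sym (proj₁ powerSeq (suc q))) (trans (periodic (+ 0)) a₀)
      minimal : ∀ k → 1 ≤ k → k < suc q → pow p (a (+ 1)) k ≢ one p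
      minimal k 1≤k k<q+1 bᵏ≡1 = contradiction
        (subst (λ x → 2 ≤ toℕ x) (trans (proj₁ powerSeq k) bᵏ≡1) (values≥2 k 1≤k (ℕ.s≤s⁻¹ k<q+1)))
        λ { (s≤s ()) }

    Φ-root : pow p (a (+ 1)) q ≡ a (+ 1) ⊕ₚ one p
    Φ-root = begin
      pow p (a (+ 1)) q    ≡⟨ proj₁ powerSeq q ⟨
      a (+ q)              ≡⟨ proj₂ seq (+ 0) ⟩
      a (+ 0) ⊕ₚ a (+ 1)   ≡⟨ cong (_⊕ₚ a (+ 1)) a₀ ⟩
      one p ⊕ₚ a (+ 1)     ≡⟨ ⊕ₚ-comm (one p) (a (+ 1)) ⟩
      a (+ 1) ⊕ₚ one p     ∎
      where open ≡-Reasoning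

    ΦPrimitiveRoot : IsΦPrimitiveRoot p q (a (+ 1))
    ΦPrimitiveRoot = primitiveRoot , Φ-root

  module Backward (pr : Prime p) {b : 𝔽 p} {a : ℤ → 𝔽 p}
                  (primitiveRoot : IsPrimitiveRoot p b) (powerSeq : IsPowerSeq p b a) where

    open PrimeCongruence p pr

    private
      minimal : ∀ k → 1 ≤ k → k < suc q → pow p b k ≢ one p
      minimal = proj₂ primitiveRoot

      powers : ∀ k → a (+ k) ≡ pow p b k
      powers = proj₁ powerSeq

      inverses : ∀ k → a (- + k) ⊗ₚ pow p b k ≡ one p
      inverses = proj₂ powerSeq

    pow-unit : ∀ k → ¬ + p ∣ ⟦ pow p b k ⟧
    pow-unit k = *≈1⇒∤ʳ {⟦ a (- + k) ⟧}
      (≈-trans (≈-sym (⟦⊗⟧ (a (- + k)) (pow p b k))) (≡⇒≈ (cong ⟦_⟧ (inverses k))))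

    pow≢0 : ∀ k → pow p b k ≢ zero
    pow≢0 k bᵏ≡0 = pow-unit k (subst (λ x → + p ∣ ⟦ x ⟧) (sym bᵏ≡0) (divides (+ 0) refl))

    geometric : Geometric b a
    geometric (+ k)    = trans (powers (suc k)) (cong (b ⊗ₚ_) (sym (powers k)))
    geometric -[1+ k ] = ⟦⟧-injective (*-cancelʳ-≈ (pow-unit k) (begin
      ⟦ a (ℤ.suc -[1+ k ]) ⟧ * ⟦ pow p b k ⟧      ≡⟨ cong (λ n → ⟦ a n ⟧ * ⟦ pow p b k ⟧) (suc-[1+k]≡-k k) ⟩
      ⟦ a (- + k) ⟧ * ⟦ pow p b k ⟧                ≈⟨ ⟦⊗⟧ (a (- + k)) _ ⟨
      ⟦ a (- + k) ⊗ₚ pow p b k ⟧                   ≡⟨ cong ⟦_⟧ (trans (inverses k) (sym (inverses (suc k)))) ⟩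
      ⟦ a -[1+ k ] ⊗ₚ (b ⊗ₚ pow p b k) ⟧           ≈⟨ ⟦⊗⟧ (a -[1+ k ]) _ ⟩
      ⟦ a -[1+ k ] ⟧ * ⟦ b ⊗ₚ pow p b k ⟧          ≈⟨ *-congˡ ⟦ a -[1+ k ] ⟧ (⟦⊗⟧ b _) ⟩
      ⟦ a -[1+ k ] ⟧ * (⟦ b ⟧ * ⟦ pow p b k ⟧)      ≡⟨ regroup ⟦ a -[1+ k ] ⟧ ⟦ b ⟧ _ ⟩
      ⟦ b ⟧ * ⟦ a -[1+ k ] ⟧ * ⟦ pow p b k ⟧        ≈⟨ *-congʳ ⟦ pow p b k ⟧ (⟦⊗⟧ b _) ⟨
      ⟦ b ⊗ₚ a -[1+ k ] ⟧ * ⟦ pow p b k ⟧           ∎))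
      where
      open ≈-Reasoning
      regroup : ∀ x y z → x * (y * z) ≡ y * x * z
      regroup = solve-∀

    powers-distinct : ∀ {i j} → i < j → j < suc q → pow p b i ≢ pow p b j
    powers-distinct {i} {j} i<j j<q+1 bⁱ≡bʲ =
      minimal d (ℕ.m<n⇒0<n∸m i<j) (ℕ.≤-<-trans (ℕ.m∸n≤m j i) j<q+1) bᵈ≡1
      where
      d : ℕ
      d = j ∸ i
      bᵈ≡1 : pow p b d ≡ one p
      bᵈ≡1 = ⟦⟧-injective (*-cancelʳ-≈ (pow-unit i) (begin
        ⟦ pow p b d ⟧ * ⟦ pow p b i ⟧     ≡⟨ cong (λ x → ⟦ pow p b d ⟧ * ⟦ x ⟧) (powers i) ⟨
        ⟦ pow p b d ⟧ * ⟦ a (+ i) ⟧       ≈⟨ geometric-shift geometric (+ i) d ⟨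
        ⟦ a (+ (i ℕ.+ d)) ⟧               ≡⟨ cong (λ n → ⟦ a (+ n) ⟧) (ℕ.m+[n∸m]≡n (ℕ.<⇒≤ i<j)) ⟩
        ⟦ a (+ j) ⟧                       ≡⟨ cong ⟦_⟧ (trans (powers j) (sym bⁱ≡bʲ)) ⟩
        ⟦ pow p b i ⟧                     ≡⟨ ℤ.*-identityˡ _ ⟨
        ⟦ one p ⟧ * ⟦ pow p b i ⟧         ∎))
        where open ≈-Reasoning

    pow-injective : ∀ {i j} → i < suc q → j < suc q → pow p b i ≡ pow p b j → i ≡ j
    pow-injective {i} {j} i<q+1 j<q+1 bⁱ≡bʲ with ℕ.<-cmp i j
    ... | tri< i<j _ _ = contradiction bⁱ≡bʲ (powers-distinct i<j j<q+1)
    ... | tri≈ _ i≡j _ = i≡j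
    ... | tri> _ _ j<i = contradiction (sym bⁱ≡bʲ) (powers-distinct j<i i<q+1)

    withZero-injective : Injective _≡_ _≡_ (withZero a)
    withZero-injective {zero}  {zero}  _     = refl
    withZero-injective {zero}  {suc j} 0≡aⱼ  =
      contradiction (trans (sym (powers (toℕ j))) (sym 0≡aⱼ)) (pow≢0 (toℕ j))
    withZero-injective {suc i} {zero}  aᵢ≡0  =
      contradiction (trans (sym (powers (toℕ i))) aᵢ≡0) (pow≢0 (toℕ i))
    withZero-injective {suc i} {suc j} aᵢ≡aⱼ = cong suc (toℕ-injective
      (pow-injective (toℕ<n i) (toℕ<n j) (trans (sym (powers (toℕ i))) (trans aᵢ≡aⱼ (powers (toℕ j))))))

    complete : IsComplete p a
    complete = geometric-periodic {b} {a} geometric (proj₁ primitiveRoot) , values≥2 , values-onto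
      where
      values≥2 : ∀ i → 1 ≤ i → i ≤ q → 2 ≤ toℕ (a (+ i))
      values≥2 i 1≤i i≤q =
        subst (λ x → 2 ≤ toℕ x) (sym (powers i)) (2≤toℕ (pow≢0 i) (minimal i 1≤i (s≤s i≤q)))
      values-onto : ∀ x → 2 ≤ toℕ x → Σ ℕ λ i → (1 ≤ i) × (i ≤ q) × (a (+ i) ≡ x)
      values-onto zero             ()
      values-onto (suc zero)       (s≤s ())
      values-onto x@(suc (suc _)) _ with injective⇒surjective (withZero a) withZero-injective x
      ... | suc (suc j) , aⱼ₊₁≡x = suc (toℕ j) , s≤s z≤n , toℕ<n j , aⱼ₊₁≡x
      ... | suc zero    , a₀≡x   = contradiction (trans (sym (powers 0)) a₀≡x) λ ()

mainTheorem9 : (p : ℕ) (pr : Prime p) → 5 ≤ p →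
    (a : ℤ → 𝔽 p {{prime⇒nonZero pr}}) →
    IsΦSeq p {{prime⇒nonZero pr}} (p ∸ 2) a →
    (IsComplete p {{prime⇒nonZero pr}} a
      ⇔ Σ (𝔽 p {{prime⇒nonZero pr}}) (λ b →
          IsΦPrimitiveRoot p {{prime⇒nonZero pr}} (p ∸ 2) b
          × IsPowerSeq p {{prime⇒nonZero pr}} b a))
mainTheorem9 _ pr p≥5@(s≤s (s≤s {n = q} _)) a seq = mk⇔
  (λ complete → a (+ 1) , ΦPrimitiveRoot complete , powerSeq complete)
  (λ (_ , (primitiveRoot , _) , powerSeq) → Residues.Backward.complete q pr primitiveRoot powerSeq)
  where
  open Residues.Forward q pr (ℕ.≤-trans (ℕ.n≤1+n 4) p≥5) {a} seq
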